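{- Let $q$ be a non-degenerate quadratic form of dimension $3$ over a finite field $F$ (so $\mathrm{char}(F)\neq 2$) and let $a\in F^\ast$. For a nonzero vector $v\in V$ we have $\mathsf d(0,v)>2$ in $\mathcal{G}_{q,a}$ if and only if $q(v)=0$ and $\det(q)\ne-a$ in $F^\ast/F^{\ast2}$. In particular, if $|F|\ge5$, then $\mathrm{diam}(\mathcal{G}_{q,a})=2$ if $\det(q)=-a$ in $F^\ast/F^{\ast 2}$, and $\mathrm{diam}(\mathcal{G}_{q,a})=3$ otherwise.
   Context: A quadratic form on a finite-dimensional $F$-vector space $V$ is a map $q:V\to F$ with $q(\lambda x)=\lambda^2q(x)$ such that $b_q(x,y)=q(x+y)-q(x)-q(y)$ is bilinear; non-degenerate means $\{x: b_q(x,y)=0\ \forall y\}=\{0\}$. $\det(q)\in F^\ast/F^{\ast2}$ is the class of $\det A$ where $q(x)=x^TAx$, $A$ symmetric, in some basis. The representation graph $\mathcal{G}_{q,a}$ has vertex set $V$, with distinct $x,y$ adjacent iff $q(x-y)=a$; $\mathsf d$ is shortest-path distance and the diameter is the supremum of distances. -}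

module Defs where

open import Level using (Level; _⊔_; suc)
open import Algebra.Bundles using (CommutativeRing)
open import Data.Nat as ℕ using (ℕ; zero; _≤_)
import Data.Nat
open import Data.Fin using (Fin)
open import Data.Product using (Σ; ∃; ∃-syntax; _×_; _,_)
open import Data.Sum using (_⊎_)
open import Relation.Nullary using (¬_)
open import Relation.Binary.PropositionalEquality using (_≡_)

record FiniteField (c ℓ : Level) : Set (Level.suc (c ⊔ ℓ)) where
  field
    commRing : CommutativeRing c ℓ
  open CommutativeRing commRing public
  field
    0≉1     : ¬ (0# ≈ 1#)
    inverse : ∀ x → ¬ (x ≈ 0#) → ∃[ y ] (x * y ≈ 1#)
    size    : ℕ
    enum    : Fin size → Carrier
    enum-surj : ∀ x → ∃[ i ] (enum i ≈ x)
    enum-inj  : ∀ i j → enum i ≈ enum j → i ≡ j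

module FF {c ℓ : Level} (F : FiniteField c ℓ) where
  open FiniteField F

  Vec3 : Set c
  Vec3 = Fin 3 → Carrier

  _≈ᵥ_ : Vec3 → Vec3 → Set ℓ
  x ≈ᵥ y = ∀ i → x i ≈ y i

  0ᵥ : Vec3
  0ᵥ _ = 0#

  _+ᵥ_ _-ᵥ_ : Vec3 → Vec3 → Vec3
  (x +ᵥ y) i = x i + y i
  (x -ᵥ y) i = x i - y i

  Matrix3 : Set c
  Matrix3 = Fin 3 → Fin 3 → Carrier

  SymmetricM : Matrix3 → Set ℓ
  SymmetricM A = ∀ i j → A i j ≈ A j i

  sum3 : (Fin 3 → Carrier) → Carrier
  sum3 f = f Fin.zero + f (Fin.suc Fin.zero) + f (Fin.suc (Fin.suc Fin.zero))

  Q : Matrix3 → Vec3 → Carrier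
  Q A x = sum3 (λ i → sum3 (λ j → A i j * x i * x j))

  B : Matrix3 → Vec3 → Vec3 → Carrier
  B A x y = Q A (x +ᵥ y) - Q A x - Q A y

  NonDegenerate : Matrix3 → Set (c ⊔ ℓ)
  NonDegenerate A = ∀ x → (∀ y → B A x y ≈ 0#) → x ≈ᵥ 0ᵥ

  det : Matrix3 → Carrier
  det A = A i0 i0 * (A i1 i1 * A i2 i2 - A i1 i2 * A i2 i1)
        - A i0 i1 * (A i1 i0 * A i2 i2 - A i1 i2 * A i2 i0)
        + A i0 i2 * (A i1 i0 * A i2 i1 - A i1 i1 * A i2 i0)
    where
    i0 i1 i2 : Fin 3
    i0 = Fin.zero
    i1 = Fin.suc Fin.zero
    i2 = Fin.suc (Fin.suc Fin.zero)

  -- equality of classes in F*/F*² (for nonzero x, y): x = y · c² for some c ≠ 0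
  SqClassEq : Carrier → Carrier → Set (c ⊔ ℓ)
  SqClassEq x y = ∃[ t ] (¬ (t ≈ 0#) × (x ≈ y * (t * t)))

  Adj : Matrix3 → Carrier → Vec3 → Vec3 → Set ℓ
  Adj A a x y = ¬ (x ≈ᵥ y) × (Q A (x -ᵥ y) ≈ a)

  -- Within A a k x y  ⇔  d(x,y) ≤ k in G_{q,a}  (a walk of length ≤ k exists)
  Within : Matrix3 → Carrier → ℕ → Vec3 → Vec3 → Set (c ⊔ ℓ)
  Within A a zero    x y = Level.Lift c (x ≈ᵥ y)
  Within A a (ℕ.suc k) x y = Level.Lift c (x ≈ᵥ y) ⊎ ∃[ z ] (Adj A a x z × Within A a k z y)

  HasDiameter : Matrix3 → Carrier → ℕ → Set (c ⊔ ℓ)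
  HasDiameter A a n = (∀ x y → Within A a n x y)
                    × (∀ m → (∀ x y → Within A a m x y) → n ≤ m)

{-# OPTIONS --safe #-}

-- Write q(x) = xᵀSx and β(x, y) = xᵀSy for the symmetric matrix S of q; then 0 and v have a
-- common neighbour x iff q(x) = a and 2β(v, x) = q(v).
-- If q(v) ≠ 0, the plane v^⊥ is non-degenerate, and a non-degenerate binary form over a finite
-- field represents every element (the sets {c₁x²} and {e - c₂y²} both have (|F|+1)/2 elements,
-- so they meet); hence x = v/2 + y with y ⊥ v and q(y) = a - q(v)/4 exists.
-- If q(v) = 0 we need x ⊥ v with q(x) = a.  For any u with β(v, u) ≠ 0 the Gram determinant of
-- (v, x, u) is both -q(x)β(v, u)² and det(v, x, u)² det S, so q(x) ∈ -det S · F*²; conversely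
-- the cross product (Sv) × u is orthogonal to v and q((Sv) × u) = -det S · (u · v)².
-- A nonzero isotropic v is at distance ≤ 3 via a neighbour x of 0 with β(v, x) = a, isotropic
-- vectors exist, and for |F| ≥ 5 some nonzero vector is not a neighbour of 0.

module Submission where

open import Defs
open import Data.Nat using (_≤_)
open import Data.Product using (_×_)
open import Relation.Nullary using (¬_)
open import Function.Bundles using (_⇔_)

open import Level using (0ℓ; lift)
open import Algebra.Bundles using (CommutativeRing; CancellativeCommutativeSemiring)
open import Algebra.Bundles.Raw using (RawRing)
open import Data.Nat.Base as ℕ using (ℕ; zero; suc)
import Data.Nat.Properties as ℕ
open import Data.Integer.Base as ℤ using (ℤ; +_; -[1+_]; _⊖_)
import Data.Integer.Properties as ℤ
open import Data.Sign.Base as Sign using (Sign)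
open import Data.Fin as Fin using (Fin; #_)
import Data.Fin.Properties as Fin
open import Data.Vec.Functional using ([]; _∷_)
import Data.Vec.Base as Vec
open import Data.Maybe.Base using (just; nothing)
open import Data.Product using (∃; ∃₂; _,_; proj₁; proj₂)
open import Data.Sum using (_⊎_; inj₁; inj₂; [_,_]′)
open import Data.Empty using (⊥; ⊥-elim)
open import Function.Base using (_∘_)
open import Function.Bundles using (mk⇔)
open import Relation.Nullary using (Dec; yes; no)
open import Relation.Nullary.Decidable using (map′; ¬?; decidable-stable)
open import Relation.Binary.Definitions using (WeaklyDecidable)
open import Relation.Binary.PropositionalEquality as ≡ using (_≡_; _≢_)
open import Algebra.Solver.Ring.AlmostCommutativeRing
  using (_-Raw-AlmostCommutative⟶_; fromCommutativeRing; Induced-equivalence)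

-- The ring solver with integer coefficients, for any commutative ring.  Coefficients must
-- compute for `refl` to identify normal forms, so the ring's own (abstract) carrier cannot serve.
module IntegerCoefficients {c ℓ} (R : CommutativeRing c ℓ) where

  open CommutativeRing R
  open import Algebra.Properties.Ring ring
    using (-‿involutive; -0#≈0#; -‿distribˡ-*; -‿distribʳ-*; -‿+-comm)
  open import Algebra.Properties.Semiring.Mult.TCOptimised semiring
    using (×-homo-+; ×1-homo-*) renaming (_×_ to _·_)
  open import Algebra.Properties.CommutativeSemigroup +-commutativeSemigroup
    using () renaming (interchange to +-interchange)
  open import Algebra.Properties.CommutativeSemigroup *-commutativeSemigroup
    using () renaming (interchange to *-interchange)
  open import Relation.Binary.Reasoning.Setoid setoid

  fromℕ : ℕ → Carrier
  fromℕ n = n · 1#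

  fromℤ : ℤ → Carrier
  fromℤ (+ n)    = fromℕ n
  fromℤ -[1+ n ] = - fromℕ (suc n)

  fromℤ-⊖ : ∀ m n → fromℤ (m ⊖ n) ≈ fromℕ m - fromℕ n
  fromℤ-⊖ m       zero    = sym (trans (+-congˡ -0#≈0#) (+-identityʳ _))
  fromℤ-⊖ zero    (suc n) = sym (+-identityˡ _)
  fromℤ-⊖ (suc m) (suc n) = begin
    fromℤ (suc m ⊖ suc n)                ≡⟨ ≡.cong fromℤ (ℤ.[1+m]⊖[1+n]≡m⊖n m n) ⟩
    fromℤ (m ⊖ n)                        ≈⟨ fromℤ-⊖ m n ⟩
    fromℕ m - fromℕ n                    ≈⟨ +-identityˡ _ ⟨
    0# + (fromℕ m - fromℕ n)             ≈⟨ +-congʳ (-‿inverseʳ 1#) ⟨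
    (1# - 1#) + (fromℕ m - fromℕ n)      ≈⟨ +-interchange _ _ _ _ ⟨
    (1# + fromℕ m) + (- 1# - fromℕ n)    ≈⟨ +-congˡ (-‿+-comm _ _) ⟩
    (1# + fromℕ m) - (1# + fromℕ n)      ≈⟨ +-cong (×-homo-+ 1# 1 m) (-‿cong (×-homo-+ 1# 1 n)) ⟨
    fromℕ (suc m) - fromℕ (suc n)        ∎

  fromℤ-+ : ∀ i j → fromℤ (i ℤ.+ j) ≈ fromℤ i + fromℤ j
  fromℤ-+ (+ m)    (+ n)    = ×-homo-+ 1# m n
  fromℤ-+ (+ m)    -[1+ n ] = fromℤ-⊖ m (suc n)
  fromℤ-+ -[1+ m ] (+ n)    = trans (fromℤ-⊖ n (suc m)) (+-comm _ _)
  fromℤ-+ -[1+ m ] -[1+ n ] = begin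
    - fromℕ (suc (suc (m ℕ.+ n)))        ≡⟨ ≡.cong (λ k → - fromℕ (suc k)) (ℕ.+-suc m n) ⟨
    - fromℕ (suc m ℕ.+ suc n)            ≈⟨ -‿cong (×-homo-+ 1# (suc m) (suc n)) ⟩
    - (fromℕ (suc m) + fromℕ (suc n))    ≈⟨ -‿+-comm _ _ ⟨
    - fromℕ (suc m) - fromℕ (suc n)      ∎

  fromℤ-neg : ∀ i → fromℤ (ℤ.- i) ≈ - fromℤ i
  fromℤ-neg (+ zero)  = sym -0#≈0#
  fromℤ-neg (+ suc n) = refl
  fromℤ-neg -[1+ n ]  = sym (-‿involutive _)

  fromSign : Sign → Carrier
  fromSign Sign.+ = 1#
  fromSign Sign.- = - 1#

  fromSign-* : ∀ s t → fromSign (s Sign.* t) ≈ fromSign s * fromSign t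
  fromSign-* Sign.+ t      = sym (*-identityˡ _)
  fromSign-* Sign.- Sign.+ = sym (*-identityʳ _)
  fromSign-* Sign.- Sign.- = begin
    1#            ≈⟨ -‿involutive 1# ⟨
    - - 1#        ≈⟨ -‿cong (*-identityʳ _) ⟨
    - (- 1# * 1#) ≈⟨ -‿distribʳ-* _ _ ⟩
    - 1# * - 1#   ∎

  fromℤ-◃ : ∀ s n → fromℤ (s ℤ.◃ n) ≈ fromSign s * fromℕ n
  fromℤ-◃ s      zero    = sym (zeroʳ _)
  fromℤ-◃ Sign.+ (suc n) = sym (*-identityˡ _)
  fromℤ-◃ Sign.- (suc n) = trans (-‿cong (sym (*-identityˡ _))) (-‿distribˡ-* _ _)

  fromℤ-signAbs : ∀ i → fromℤ i ≈ fromSign (ℤ.sign i) * fromℕ ℤ.∣ i ∣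
  fromℤ-signAbs i = trans (reflexive (≡.cong fromℤ (≡.sym (ℤ.◃-inverse i)))) (fromℤ-◃ (ℤ.sign i) ℤ.∣ i ∣)

  fromℤ-* : ∀ i j → fromℤ (i ℤ.* j) ≈ fromℤ i * fromℤ j
  fromℤ-* i j = begin
    fromℤ (i ℤ.* j)                                 ≈⟨ fromℤ-◃ (s Sign.* t) (m ℕ.* n) ⟩
    fromSign (s Sign.* t) * fromℕ (m ℕ.* n)         ≈⟨ *-cong (fromSign-* s t) (×1-homo-* m n) ⟩
    (fromSign s * fromSign t) * (fromℕ m * fromℕ n) ≈⟨ *-interchange _ _ _ _ ⟩
    (fromSign s * fromℕ m) * (fromSign t * fromℕ n) ≈⟨ *-cong (fromℤ-signAbs i) (fromℤ-signAbs j) ⟨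
    fromℤ i * fromℤ j                               ∎
    where s = ℤ.sign i ; t = ℤ.sign j ; m = ℤ.∣ i ∣ ; n = ℤ.∣ j ∣

  ℤ⟶R : ℤ.+-*-rawRing -Raw-AlmostCommutative⟶ fromCommutativeRing R
  ℤ⟶R = record
    { ⟦_⟧    = fromℤ
    ; +-homo = fromℤ-+
    ; *-homo = fromℤ-*
    ; -‿homo = fromℤ-neg
    ; 0-homo = refl
    ; 1-homo = refl
    }

  fromℤ-≟ : WeaklyDecidable (Induced-equivalence ℤ⟶R)
  fromℤ-≟ i j with i ℤ.≟ j
  ... | yes ≡.refl = just refl
  ... | no _       = nothing

  open import Algebra.Solver.Ring ℤ.+-*-rawRing (fromCommutativeRing R) ℤ⟶R fromℤ-≟ public
    using (solve; _:=_; prove; Polynomial; con; var; _:+_; _:*_; :-_)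

  :0 :1 : ∀ {n} → Polynomial n
  :0 = con (+ 0)
  :1 = con (+ 1)

  polynomials : ℕ → RawRing 0ℓ 0ℓ
  polynomials n = record
    { Carrier = Polynomial n ; _≈_ = _≡_
    ; _+_ = _:+_ ; _*_ = _:*_ ; -_ = :-_ ; 0# = :0 ; 1# = :1 }

module ThreeSpace {c ℓ} (R : RawRing c ℓ) where

  open RawRing R

  infixl 6 _-_ _+ᵥ_ _-ᵥ_
  infixl 7 _·ᵥ_ _⨯_ _∙_ _⊛_
  infix 4 _≈ᵥ_

  _-_ : Carrier → Carrier → Carrier
  x - y = x + - y

  Vector : Set c
  Vector = Fin 3 → Carrier

  Matrix : Set c
  Matrix = Fin 3 → Vector

  _≈ᵥ_ : Vector → Vector → Set ℓ
  u ≈ᵥ v = ∀ i → u i ≈ v i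

  0ᵥ : Vector
  0ᵥ _ = 0#

  _+ᵥ_ _-ᵥ_ : Vector → Vector → Vector
  (u +ᵥ v) i = u i + v i
  (u -ᵥ v) i = u i - v i

  _·ᵥ_ : Carrier → Vector → Vector
  (s ·ᵥ v) i = s * v i

  sum₃ : Vector → Carrier
  sum₃ f = f (# 0) + f (# 1) + f (# 2)

  _∙_ : Vector → Vector → Carrier
  u ∙ v = sum₃ (λ i → u i * v i)

  _⨯_ : Vector → Vector → Vector
  u ⨯ v = u (# 1) * v (# 2) - u (# 2) * v (# 1)
        ∷ u (# 2) * v (# 0) - u (# 0) * v (# 2)
        ∷ u (# 0) * v (# 1) - u (# 1) * v (# 0) ∷ []

  det₃ : Vector → Vector → Vector → Carrier
  det₃ u v w = u ∙ (v ⨯ w)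

  _⊛_ : Matrix → Vector → Vector
  (M ⊛ v) i = M i ∙ v

  symmetric : (a b c d e f : Carrier) → Matrix
  symmetric a b c d e f = (a ∷ b ∷ c ∷ []) ∷ (b ∷ d ∷ e ∷ []) ∷ (c ∷ e ∷ f ∷ []) ∷ []

  quadratic : Matrix → Vector → Carrier
  quadratic M x = sum₃ (λ i → sum₃ (λ j → M i j * x i * x j))

  bilinear : Matrix → Vector → Vector → Carrier
  bilinear M x y = x ∙ (M ⊛ y)

  determinant : Matrix → Carrier
  determinant M = M (# 0) (# 0) * (M (# 1) (# 1) * M (# 2) (# 2) - M (# 1) (# 2) * M (# 2) (# 1))
                - M (# 0) (# 1) * (M (# 1) (# 0) * M (# 2) (# 2) - M (# 1) (# 2) * M (# 2) (# 0))
                + M (# 0) (# 2) * (M (# 1) (# 0) * M (# 2) (# 1) - M (# 1) (# 1) * M (# 2) (# 0))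

  adjugate : Matrix → Matrix
  adjugate M = M (# 1) ⨯ M (# 2) ∷ M (# 2) ⨯ M (# 0) ∷ M (# 0) ⨯ M (# 1) ∷ []

  unit : Fin 3 → Vector
  unit = (1# ∷ 0# ∷ 0# ∷ []) ∷ (0# ∷ 1# ∷ 0# ∷ []) ∷ (0# ∷ 0# ∷ 1# ∷ []) ∷ []

  gramRow : Matrix → Vector → Vector → Vector → Vector → Vector
  gramRow M x y z u = bilinear M u x ∷ bilinear M u y ∷ bilinear M u z ∷ []

  gram : Matrix → Vector → Vector → Vector → Carrier
  gram M x y z = det₃ (gramRow M x y z x) (gramRow M x y z y) (gramRow M x y z z)

module VectorSolver {r ℓ} (R : CommutativeRing r ℓ) where

  open CommutativeRing R
  open IntegerCoefficients R public using (solve; _:=_; prove; var; _:+_; _:*_; :-_; :0; :1; polynomials)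
  open ThreeSpace rawRing using (Vector)
  module E {n} = ThreeSpace (polynomials n)

  infixr 5 _▸_
  _▸_ : ∀ {n} → Vector → Vec.Vec Carrier n → Vec.Vec Carrier (3 ℕ.+ n)
  v ▸ ρ = v (# 0) Vec.∷ v (# 1) Vec.∷ v (# 2) Vec.∷ ρ

  variables : ∀ {n} → Fin n → Fin n → Fin n → E.Vector {n}
  variables i j k = var i ∷ var j ∷ var k ∷ []

module VectorLaws {r ℓ} (R : CommutativeRing r ℓ) where

  open CommutativeRing R
  open ThreeSpace rawRing public hiding (_-_)
  private
    open VectorSolver R
    û : ∀ {n} → E.Vector {3 ℕ.+ n}
    û = variables (# 0) (# 1) (# 2)
    v̂ : ∀ {n} → E.Vector {6 ℕ.+ n}
    v̂ = variables (# 3) (# 4) (# 5)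
    ŵ : ∀ {n} → E.Vector {9 ℕ.+ n}
    ŵ = variables (# 6) (# 7) (# 8)

  ⨯-orthogonalˡ : ∀ u v → u ∙ (u ⨯ v) ≈ 0#
  ⨯-orthogonalˡ u v = prove (u ▸ v ▸ Vec.[]) (û E.∙ (û E.⨯ v̂)) (:0) refl

  det₃-rotate : ∀ u v w → det₃ u v w ≈ det₃ w u v
  det₃-rotate u v w = prove (u ▸ v ▸ w ▸ Vec.[]) (E.det₃ û v̂ ŵ) (E.det₃ ŵ û v̂) refl

  det₃-cross : ∀ u v w x → det₃ x (u ⨯ v) (u ⨯ w) ≈ (x ∙ u) * det₃ u v w
  det₃-cross u v w x = prove (u ▸ v ▸ w ▸ x ▸ Vec.[])
    (E.det₃ x̂ (û E.⨯ v̂) (û E.⨯ ŵ)) ((x̂ E.∙ û) :* E.det₃ û v̂ ŵ) refl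
    where x̂ = variables (# 9) (# 10) (# 11)

  ∙-unitˡ : ∀ i v → unit i ∙ v ≈ v i
  ∙-unitˡ Fin.zero                     v = prove (v ▸ Vec.[]) (E.unit (# 0) E.∙ û) (var (# 0)) refl
  ∙-unitˡ (Fin.suc Fin.zero)           v = prove (v ▸ Vec.[]) (E.unit (# 1) E.∙ û) (var (# 1)) refl
  ∙-unitˡ (Fin.suc (Fin.suc Fin.zero)) v = prove (v ▸ Vec.[]) (E.unit (# 2) E.∙ û) (var (# 2)) refl

  det₃-units : ∀ i v → ∃₂ λ u w → det₃ v u w ≈ v i
  det₃-units Fin.zero                     v =
    unit (# 1) , unit (# 2) , prove (v ▸ Vec.[]) (E.det₃ û (E.unit (# 1)) (E.unit (# 2))) (var (# 0)) refl
  det₃-units (Fin.suc Fin.zero)           v =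
    unit (# 2) , unit (# 0) , prove (v ▸ Vec.[]) (E.det₃ û (E.unit (# 2)) (E.unit (# 0))) (var (# 1)) refl
  det₃-units (Fin.suc (Fin.suc Fin.zero)) v =
    unit (# 0) , unit (# 1) , prove (v ▸ Vec.[]) (E.det₃ û (E.unit (# 0)) (E.unit (# 1))) (var (# 2)) refl

  ∙-zeroʳ : ∀ u → u ∙ 0ᵥ ≈ 0#
  ∙-zeroʳ u = prove (u ▸ Vec.[]) (û E.∙ E.0ᵥ) (:0) refl

  ∙-cong : ∀ {u u′ v v′} → u ≈ᵥ u′ → v ≈ᵥ v′ → u ∙ v ≈ u′ ∙ v′
  ∙-cong p p′ = +-cong (+-cong (*-cong (p (# 0)) (p′ (# 0))) (*-cong (p (# 1)) (p′ (# 1))))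
                       (*-cong (p (# 2)) (p′ (# 2)))

  quadratic-cong : ∀ {M N} → (∀ i j → M i j ≈ N i j) → ∀ x → quadratic M x ≈ quadratic N x
  quadratic-cong {M} {N} M≈N x = +-cong (+-cong (row (# 0)) (row (# 1))) (row (# 2))
    where
    row : ∀ i → sum₃ (λ j → M i j * x i * x j) ≈ sum₃ (λ j → N i j * x i * x j)
    row i = +-cong (+-cong (*-congʳ (*-congʳ (M≈N i (# 0)))) (*-congʳ (*-congʳ (M≈N i (# 1)))))
                   (*-congʳ (*-congʳ (M≈N i (# 2))))

  determinant-cong : ∀ {M N} → (∀ i j → M i j ≈ N i j) → determinant M ≈ determinant N
  determinant-cong M≈N =
    +-cong (+-cong (*-cong (M≈N i₀ i₀) (minor (M≈N i₁ i₁) (M≈N i₂ i₂) (M≈N i₁ i₂) (M≈N i₂ i₁)))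
                   (-‿cong (*-cong (M≈N i₀ i₁) (minor (M≈N i₁ i₀) (M≈N i₂ i₂) (M≈N i₁ i₂) (M≈N i₂ i₀)))))
           (*-cong (M≈N i₀ i₂) (minor (M≈N i₁ i₀) (M≈N i₂ i₁) (M≈N i₁ i₁) (M≈N i₂ i₀)))
    where
    i₀ = # 0 ; i₁ = # 1 ; i₂ = # 2
    minor : ∀ {w w′ x x′ y y′ z z′} → w ≈ w′ → x ≈ x′ → y ≈ y′ → z ≈ z′ → w * x - y * z ≈ w′ * x′ - y′ * z′
    minor w x y z = +-cong (*-cong w x) (-‿cong (*-cong y z))

module SymmetricForm {r ℓ} (R : CommutativeRing r ℓ) (a b c d e f : CommutativeRing.Carrier R) where

  open CommutativeRing R
  open VectorLaws R public

  S : Matrix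
  S = symmetric a b c d e f

  q : Vector → Carrier
  q = quadratic S

  β : Vector → Vector → Carrier
  β = bilinear S

  Δ : Carrier
  Δ = determinant S

  -- solver environments: the entries of S, then the coordinates of the vectors, then scalars
  private
    open VectorSolver R
    entries : ∀ {n} → Vec.Vec Carrier n → Vec.Vec Carrier (6 ℕ.+ n)
    entries ρ = a Vec.∷ b Vec.∷ c Vec.∷ d Vec.∷ e Vec.∷ f Vec.∷ ρ
    Ŝ : ∀ {n} → E.Matrix {6 ℕ.+ n}
    Ŝ = E.symmetric (var (# 0)) (var (# 1)) (var (# 2)) (var (# 3)) (var (# 4)) (var (# 5))
    x̂ : ∀ {n} → E.Vector {9 ℕ.+ n}
    x̂ = variables (# 6) (# 7) (# 8)
    ŷ : ∀ {n} → E.Vector {12 ℕ.+ n}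
    ŷ = variables (# 9) (# 10) (# 11)
    ẑ : ∀ {n} → E.Vector {15 ℕ.+ n}
    ẑ = variables (# 12) (# 13) (# 14)

  β-sym : ∀ u v → β u v ≈ β v u
  β-sym u v = prove (entries (u ▸ v ▸ Vec.[])) (E.bilinear Ŝ x̂ ŷ) (E.bilinear Ŝ ŷ x̂) refl

  β-transpose : ∀ u v → β u v ≈ (S ⊛ u) ∙ v
  β-transpose u v = prove (entries (u ▸ v ▸ Vec.[])) (E.bilinear Ŝ x̂ ŷ) ((Ŝ E.⊛ x̂) E.∙ ŷ) refl

  β-self : ∀ v → β v v ≈ q v
  β-self v = prove (entries (v ▸ Vec.[])) (E.bilinear Ŝ x̂ x̂) (E.quadratic Ŝ x̂) refl

  β-zeroʳ : ∀ v → β v 0ᵥ ≈ 0#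
  β-zeroʳ v = prove (entries (v ▸ Vec.[])) (E.bilinear Ŝ x̂ E.0ᵥ) (:0) refl

  β-scale : ∀ s v u → β v (s ·ᵥ u) ≈ s * β v u
  β-scale s v u = prove (entries (v ▸ u ▸ s Vec.∷ Vec.[]))
    (E.bilinear Ŝ x̂ (var (# 12) E.·ᵥ ŷ)) (var (# 12) :* E.bilinear Ŝ x̂ ŷ) refl

  β-combination : ∀ s r v u w → β v (s ·ᵥ u +ᵥ r ·ᵥ w) ≈ s * β v u + r * β v w
  β-combination s r v u w = prove (entries (v ▸ u ▸ w ▸ s Vec.∷ r Vec.∷ Vec.[]))
    (E.bilinear Ŝ x̂ (ŝ E.·ᵥ ŷ E.+ᵥ r̂ E.·ᵥ ẑ)) (ŝ :* E.bilinear Ŝ x̂ ŷ :+ r̂ :* E.bilinear Ŝ x̂ ẑ) refl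
    where ŝ = var (# 15) ; r̂ = var (# 16)

  q-zero : q 0ᵥ ≈ 0#
  q-zero = prove (entries Vec.[]) (E.quadratic Ŝ E.0ᵥ) (:0) refl

  q-neg : ∀ v → q (0ᵥ -ᵥ v) ≈ q v
  q-neg v = prove (entries (v ▸ Vec.[])) (E.quadratic Ŝ (E.0ᵥ E.-ᵥ x̂)) (E.quadratic Ŝ x̂) refl

  q-diff : ∀ u v → q (u -ᵥ v) ≈ q u - (β u v + β u v) + q v
  q-diff u v = prove (entries (u ▸ v ▸ Vec.[])) (E.quadratic Ŝ (x̂ E.-ᵥ ŷ))
    (E.quadratic Ŝ x̂ :+ :- (E.bilinear Ŝ x̂ ŷ :+ E.bilinear Ŝ x̂ ŷ) :+ E.quadratic Ŝ ŷ) refl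

  q-sum : ∀ u v → q (u +ᵥ v) ≈ q u + (β u v + β u v) + q v
  q-sum u v = prove (entries (u ▸ v ▸ Vec.[])) (E.quadratic Ŝ (x̂ E.+ᵥ ŷ))
    (E.quadratic Ŝ x̂ :+ (E.bilinear Ŝ x̂ ŷ :+ E.bilinear Ŝ x̂ ŷ) :+ E.quadratic Ŝ ŷ) refl

  q-scale : ∀ s v → q (s ·ᵥ v) ≈ s * s * q v
  q-scale s v = prove (entries (v ▸ s Vec.∷ Vec.[]))
    (E.quadratic Ŝ (var (# 9) E.·ᵥ x̂)) (var (# 9) :* var (# 9) :* E.quadratic Ŝ x̂) refl

  q-combination : ∀ s r u w →
    q (s ·ᵥ u +ᵥ r ·ᵥ w) ≈ s * s * q u + (s * r * β u w + s * r * β u w) + r * r * q w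
  q-combination s r u w = prove (entries (u ▸ w ▸ s Vec.∷ r Vec.∷ Vec.[]))
    (E.quadratic Ŝ (ŝ E.·ᵥ x̂ E.+ᵥ r̂ E.·ᵥ ŷ))
    (ŝ :* ŝ :* E.quadratic Ŝ x̂ :+ (ŝ :* r̂ :* E.bilinear Ŝ x̂ ŷ :+ ŝ :* r̂ :* E.bilinear Ŝ x̂ ŷ)
       :+ r̂ :* r̂ :* E.quadratic Ŝ ŷ) refl
    where ŝ = var (# 12) ; r̂ = var (# 13)

  cross-quadratic : ∀ v u → q ((S ⊛ v) ⨯ u) ≈ quadratic (adjugate S) u * q v - Δ * ((u ∙ v) * (u ∙ v))
  cross-quadratic v u = prove (entries (v ▸ u ▸ Vec.[])) (E.quadratic Ŝ ((Ŝ E.⊛ x̂) E.⨯ ŷ))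
    (E.quadratic (E.adjugate Ŝ) ŷ :* E.quadratic Ŝ x̂
       :+ :- (E.determinant Ŝ :* ((ŷ E.∙ x̂) :* (ŷ E.∙ x̂)))) refl

  det₃-image : ∀ x y z → det₃ (S ⊛ x) (S ⊛ y) (S ⊛ z) ≈ Δ * det₃ x y z
  det₃-image x y z = prove (entries (x ▸ y ▸ z ▸ Vec.[]))
    (E.det₃ (Ŝ E.⊛ x̂) (Ŝ E.⊛ ŷ) (Ŝ E.⊛ ẑ)) (E.determinant Ŝ :* E.det₃ x̂ ŷ ẑ) refl

  gram-det₃ : ∀ x y z → gram S x y z ≈ det₃ x y z * det₃ x y z * Δ
  gram-det₃ x y z = prove (entries (x ▸ y ▸ z ▸ Vec.[]))
    (E.gram Ŝ x̂ ŷ ẑ) (E.det₃ x̂ ŷ ẑ :* E.det₃ x̂ ŷ ẑ :* E.determinant Ŝ) refl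

  cross-orthogonal : ∀ v u → β v ((S ⊛ v) ⨯ u) ≈ 0#
  cross-orthogonal v u = trans (β-transpose v ((S ⊛ v) ⨯ u)) (⨯-orthogonalˡ (S ⊛ v) u)

  β-cong : ∀ {u u′ v v′} → u ≈ᵥ u′ → v ≈ᵥ v′ → β u v ≈ β u′ v′
  β-cong p p′ = ∙-cong p (λ i → ∙-cong {S i} (λ _ → refl) p′)

  q-cong : ∀ {u v} → u ≈ᵥ v → q u ≈ q v
  q-cong {u} {v} p = trans (sym (β-self u)) (trans (β-cong p p) (β-self v))

  gram-orthogonal : ∀ v x y → β v x ≈ 0# → β v y ≈ 0# →
                    gram S v x y ≈ q v * (q x * q y - β x y * β x y)
  gram-orthogonal v x y vx≈0 vy≈0 = begin
    gram S v x y
      ≈⟨ +-cong (+-cong (*-congʳ (β-self v)) (*-congʳ vx≈0)) (*-congʳ vy≈0) ⟩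
    q v * (β x x * β y y - β x y * β y x) + 0# * _ + 0# * _
      ≈⟨ solve 4 (λ Q C D E → Q :* C :+ :0 :* D :+ :0 :* E := Q :* C) refl (q v) _ _ _ ⟩
    q v * (β x x * β y y - β x y * β y x)
      ≈⟨ *-congˡ (+-cong (*-cong (β-self x) (β-self y)) (-‿cong (*-congˡ (β-sym y x)))) ⟩
    q v * (q x * q y - β x y * β x y) ∎
    where open import Relation.Binary.Reasoning.Setoid setoid

  gram-isotropic : ∀ v x u → q v ≈ 0# → β v x ≈ 0# → gram S v x u ≈ - (q x * (β v u * β v u))
  gram-isotropic v x u qv≈0 vx≈0 = begin
    gram S v x u
      ≈⟨ +-cong (+-cong (*-congʳ (trans (β-self v) qv≈0)) (*-congʳ vx≈0))
                (*-congˡ (+-cong (*-congʳ (trans (β-sym x v) vx≈0))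
                                 (-‿cong (*-cong (β-self x) (β-sym u v))))) ⟩
    0# * _ + 0# * _ + β v u * (0# * β u x - q x * β v u)
      ≈⟨ solve 5 (λ C D p B Q → :0 :* C :+ :0 :* D :+ p :* (:0 :* B :+ :- (Q :* p))
                               := :- (Q :* (p :* p))) refl _ _ (β v u) (β u x) (q x) ⟩
    - (q x * (β v u * β v u)) ∎
    where open import Relation.Binary.Reasoning.Setoid setoid

injective-endomap-hits : ∀ {n} (f : Fin n → Fin n) → (∀ {i j} → f i ≡ f j → i ≡ j) →
                         ∀ m → ¬ (∀ i → f i ≢ m)
injective-endomap-hits {suc n} f f-injective m misses = Fin.<⇒notInjective (ℕ.n<1+n n)
  (λ eq → f-injective (Fin.punchOut-injective (misses _ ∘ ≡.sym) (misses _ ∘ ≡.sym) eq))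

module FiniteFieldProperties {c ℓ} (F : FiniteField c ℓ) where

  open FiniteField F
  open VectorLaws commRing using (_≈ᵥ_; 0ᵥ; unit; _∙_; det₃; ∙-unitˡ; det₃-units)
  open import Relation.Binary.Reasoning.Setoid setoid
  open import Algebra.Properties.Ring ring using (-‿involutive; -‿injective; -0#≈0#; +-cancelˡ; x∙y⁻¹≈ε⇒x≈y)
  open IntegerCoefficients commRing using (solve; _:=_; _:+_; _:*_; :-_; :0; :1)

  index : Carrier → Fin size
  index x = proj₁ (enum-surj x)

  enum-index : ∀ x → enum (index x) ≈ x
  enum-index x = proj₂ (enum-surj x)

  index-cong : ∀ {x y} → x ≈ y → index x ≡ index y
  index-cong {x} {y} x≈y = enum-inj _ _ (trans (enum-index x) (trans x≈y (sym (enum-index y))))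

  index-injective : ∀ {x y} → index x ≡ index y → x ≈ y
  index-injective {x} {y} eq = trans (sym (enum-index x)) (trans (reflexive (≡.cong enum eq)) (enum-index y))

  infix 4 _≟_
  _≟_ : ∀ x y → Dec (x ≈ y)
  x ≟ y = map′ index-injective index-cong (index x Fin.≟ index y)

  any? : ∀ {p} {P : Carrier → Set p} → (∀ {x y} → x ≈ y → P x → P y) →
         (∀ x → Dec (P x)) → Dec (∃ P)
  any? resp P? = map′ (λ (i , Pi) → enum i , Pi) (λ (x , Px) → index x , resp (sym (enum-index x)) Px)
                      (Fin.any? (P? ∘ enum))

  inv : ∀ x → x ≉ 0# → Carrier
  inv x x≉0 = proj₁ (inverse x x≉0)

  *-inverseʳ : ∀ x (x≉0 : x ≉ 0#) → x * inv x x≉0 ≈ 1#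
  *-inverseʳ x x≉0 = proj₂ (inverse x x≉0)

  *-cancelˡ : ∀ x {y z} → x ≉ 0# → x * y ≈ x * z → y ≈ z
  *-cancelˡ x {y} {z} x≉0 xy≈xz = begin
    y                  ≈⟨ x·x⁻¹· y ⟨
    (x * x⁻¹) * y      ≈⟨ solve 3 (λ x x⁻¹ y → (x :* x⁻¹) :* y := x⁻¹ :* (x :* y)) refl x x⁻¹ y ⟩
    x⁻¹ * (x * y)      ≈⟨ *-congˡ xy≈xz ⟩
    x⁻¹ * (x * z)      ≈⟨ solve 3 (λ x x⁻¹ z → x⁻¹ :* (x :* z) := (x :* x⁻¹) :* z) refl x x⁻¹ z ⟩
    (x * x⁻¹) * z      ≈⟨ x·x⁻¹· z ⟩
    z                  ∎
    where
    x⁻¹ = inv x x≉0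
    x·x⁻¹· : ∀ w → (x * x⁻¹) * w ≈ w
    x·x⁻¹· w = trans (*-congʳ (*-inverseʳ x x≉0)) (*-identityˡ w)

  cancellativeCommutativeSemiring : CancellativeCommutativeSemiring c ℓ
  cancellativeCommutativeSemiring = record
    { isCancellativeCommutativeSemiring = record
      { isCommutativeSemiring = isCommutativeSemiring
      ; *-cancelˡ-nonZero     = λ x _ _ → *-cancelˡ x
      }
    }

  open import Algebra.Properties.CancellativeCommutativeSemiring cancellativeCommutativeSemiring
    using (xy≈0⇒x≈0∨y≈0; x≉0∧y≉0⇒xy≉0)

  *-≉0 : ∀ {x y} → x ≉ 0# → y ≉ 0# → x * y ≉ 0#
  *-≉0 = x≉0∧y≉0⇒xy≉0 _≟_

  inv-≉0 : ∀ x (x≉0 : x ≉ 0#) → inv x x≉0 ≉ 0#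
  inv-≉0 x x≉0 x⁻¹≈0 = 0≉1 (begin
    0#             ≈⟨ zeroʳ x ⟨
    x * 0#         ≈⟨ *-congˡ x⁻¹≈0 ⟨
    x * inv x x≉0  ≈⟨ *-inverseʳ x x≉0 ⟩
    1#             ∎)

  square-root : ∀ {x y} → x * x ≈ y * y → x ≈ y ⊎ x ≈ - y
  square-root {x} {y} x²≈y² with xy≈0⇒x≈0∨y≈0 _≟_ factored
    where
    factored : (x - y) * (x + y) ≈ 0#
    factored = begin
      (x - y) * (x + y)  ≈⟨ solve 2 (λ x y → (x :+ :- y) :* (x :+ y) := x :* x :+ :- (y :* y)) refl x y ⟩
      x * x - y * y      ≈⟨ +-congʳ x²≈y² ⟩
      y * y - y * y      ≈⟨ -‿inverseʳ (y * y) ⟩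
      0#                 ∎
  ... | inj₁ x-y≈0 = inj₁ (x∙y⁻¹≈ε⇒x≈y x y x-y≈0)
  ... | inj₂ x+y≈0 = inj₂ (x∙y⁻¹≈ε⇒x≈y x (- y) (trans (+-congˡ (-‿involutive y)) x+y≈0))

  *-inverse-cancelˡ : ∀ x (x≉0 : x ≉ 0#) y → x * (y * inv x x≉0) ≈ y
  *-inverse-cancelˡ x x≉0 y = begin
    x * (y * inv x x≉0)  ≈⟨ solve 3 (λ x y x⁻¹ → x :* (y :* x⁻¹) := y :* (x :* x⁻¹)) refl x y (inv x x≉0) ⟩
    y * (x * inv x x≉0)  ≈⟨ *-congˡ (*-inverseʳ x x≉0) ⟩
    y * 1#               ≈⟨ *-identityʳ y ⟩
    y                    ∎

  module _ {c₁ c₂ e} (c₁≉0 : c₁ ≉ 0#) (c₂≉0 : c₂ ≉ 0#)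
           (unsolvable : ∀ x y → c₁ * (x * x) + c₂ * (y * y) ≉ e) where

    -- Ψ x is c₁x² or e - c₂x² according to whether x precedes -x in the enumeration;
    -- without solutions Ψ is an injection of F into F missing 0.
    private
      Ψ : Carrier → Carrier
      Ψ x with index x Fin.<? index (- x)
      ... | yes _ = c₁ * (x * x)
      ... | no  _ = e - c₂ * (x * x)

      separated : ∀ x y → c₁ * (x * x) ≉ e - c₂ * (y * y)
      separated x y eq = unsolvable x y (begin
        c₁ * (x * x) + c₂ * (y * y)      ≈⟨ +-congʳ eq ⟩
        e - c₂ * (y * y) + c₂ * (y * y)  ≈⟨ solve 2 (λ e u → e :+ :- u :+ u := e) refl e (c₂ * (y * y)) ⟩
        e                                ∎)

      negated : ∀ {x y} → x ≈ - y → - x ≈ y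
      negated {x} {y} x≈-y = trans (-‿cong x≈-y) (-‿involutive y)

      both-positive : ∀ {x y} → index x Fin.< index (- x) → index y Fin.< index (- y) →
                      x ≈ y ⊎ x ≈ - y → x ≈ y
      both-positive x⁺ y⁺ (inj₁ x≈y)  = x≈y
      both-positive x⁺ y⁺ (inj₂ x≈-y) = ⊥-elim (Fin.<-asym x⁺
        (≡.subst₂ Fin._<_ (≡.sym (index-cong (negated x≈-y))) (index-cong (sym x≈-y)) y⁺))

      both-negative : ∀ {x y} → ¬ index x Fin.< index (- x) → ¬ index y Fin.< index (- y) →
                      x ≈ y ⊎ x ≈ - y → x ≈ y
      both-negative x⁻ y⁻ (inj₁ x≈y)  = x≈y
      both-negative x⁻ y⁻ (inj₂ x≈-y) = trans x≈-x (negated x≈-y)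
        where
        x≈-x = index-injective (Fin.≤-antisym
          (≡.subst₂ Fin._≤_ (index-cong (sym x≈-y)) (≡.sym (index-cong (negated x≈-y))) (ℕ.≮⇒≥ y⁻))
          (ℕ.≮⇒≥ x⁻))

      Ψ-injective : ∀ x y → Ψ x ≈ Ψ y → x ≈ y
      Ψ-injective x y Ψx≈Ψy with index x Fin.<? index (- x) | index y Fin.<? index (- y)
      ... | yes x⁺ | yes y⁺ = both-positive x⁺ y⁺ (square-root (*-cancelˡ c₁ c₁≉0 Ψx≈Ψy))
      ... | yes _  | no _   = ⊥-elim (separated x y Ψx≈Ψy)
      ... | no _   | yes _  = ⊥-elim (separated y x (sym Ψx≈Ψy))
      ... | no x⁻  | no y⁻  = both-negative x⁻ y⁻
        (square-root (*-cancelˡ c₂ c₂≉0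
          (-‿injective (+-cancelˡ e (- (c₂ * (x * x))) (- (c₂ * (y * y))) Ψx≈Ψy))))

      Ψ-≉0 : ∀ x → Ψ x ≉ 0#
      Ψ-≉0 x Ψx≈0 with index x Fin.<? index (- x)
      ... | yes x⁺ = Fin.<-irrefl (≡.trans (index-cong x≈0) (index-cong (sym -x≈0))) x⁺
        where
        x≈0 : x ≈ 0#
        x≈0 = decidable-stable (x ≟ 0#) λ x≉0 →
          *-≉0 x≉0 x≉0 (*-cancelˡ c₁ c₁≉0 (trans Ψx≈0 (sym (zeroʳ c₁))))
        -x≈0 : - x ≈ 0#
        -x≈0 = trans (-‿cong x≈0) -0#≈0#
      ... | no _ = separated 0# x (begin
        c₁ * (0# * 0#)    ≈⟨ trans (*-congˡ (zeroˡ 0#)) (zeroʳ c₁) ⟩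
        0#                ≈⟨ Ψx≈0 ⟨
        e - c₂ * (x * x)  ∎)

    unsolvable⇒⊥ : ⊥
    unsolvable⇒⊥ = injective-endomap-hits (index ∘ Ψ ∘ enum)
      (λ eq → enum-inj _ _ (Ψ-injective _ _ (index-injective eq))) (index 0#)
      (λ i eq → Ψ-≉0 (enum i) (index-injective eq))

  sum-of-squares : ∀ {c₁ c₂} → c₁ ≉ 0# → c₂ ≉ 0# → ∀ e → ∃₂ λ x y → c₁ * (x * x) + c₂ * (y * y) ≈ e
  sum-of-squares {c₁} {c₂} c₁≉0 c₂≉0 e
    with any? resp (λ x → any? (resp′ x) (λ y → c₁ * (x * x) + c₂ * (y * y) ≟ e))
    where
    resp′ : ∀ x {y y′} → y ≈ y′ → c₁ * (x * x) + c₂ * (y * y) ≈ e → c₁ * (x * x) + c₂ * (y′ * y′) ≈ e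
    resp′ x y≈y′ = trans (+-congˡ (*-congˡ (*-cong (sym y≈y′) (sym y≈y′))))
    resp : ∀ {x x′} → x ≈ x′ → ∃ (λ y → c₁ * (x * x) + c₂ * (y * y) ≈ e) →
                               ∃ (λ y → c₁ * (x′ * x′) + c₂ * (y * y) ≈ e)
    resp x≈x′ (y , eq) = y , trans (+-congʳ (*-congˡ (*-cong (sym x≈x′) (sym x≈x′)))) eq
  ... | yes solution = solution
  ... | no ∄solution = ⊥-elim (unsolvable⇒⊥ c₁≉0 c₂≉0 (λ x y eq → ∄solution (x , y , eq)))

  binary-form-universal : ∀ {Q₁ Q₂ B} → 1# + 1# ≉ 0# → Q₁ * Q₂ - B * B ≉ 0# →
    ∀ γ → ∃₂ λ s r → s * s * Q₁ + (s * r * B + s * r * B) + r * r * Q₂ ≈ γ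
  binary-form-universal {Q₁} {Q₂} {B} 2≉0 D≉0 γ with Q₁ ≟ 0#
  ... | no Q₁≉0 = complete-square (sum-of-squares (λ 1≈0 → 0≉1 (sym 1≈0)) D≉0 (Q₁ * γ))
    where
    D = Q₁ * Q₂ - B * B
    complete-square : ∃₂ (λ X r → 1# * (X * X) + D * (r * r) ≈ Q₁ * γ) →
                      ∃₂ λ s r → s * s * Q₁ + (s * r * B + s * r * B) + r * r * Q₂ ≈ γ
    complete-square (X , r , X²+Dr²≈Q₁γ) = s , r , *-cancelˡ Q₁ Q₁≉0 (begin
      Q₁ * (s * s * Q₁ + (s * r * B + s * r * B) + r * r * Q₂)
        ≈⟨ solve 5 (λ Q₁ Q₂ B s r →
             Q₁ :* (s :* s :* Q₁ :+ (s :* r :* B :+ s :* r :* B) :+ r :* r :* Q₂)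
             := (Q₁ :* s :+ B :* r) :* (Q₁ :* s :+ B :* r) :+ (Q₁ :* Q₂ :+ :- (B :* B)) :* (r :* r))
             refl Q₁ Q₂ B s r ⟩
      (Q₁ * s + B * r) * (Q₁ * s + B * r) + D * (r * r)  ≈⟨ +-congʳ (*-cong Q₁s+Br≈X Q₁s+Br≈X) ⟩
      X * X + D * (r * r)                                ≈⟨ +-congʳ (*-identityˡ (X * X)) ⟨
      1# * (X * X) + D * (r * r)                         ≈⟨ X²+Dr²≈Q₁γ ⟩
      Q₁ * γ                                             ∎)
      where
      s = (X - B * r) * inv Q₁ Q₁≉0
      Q₁s+Br≈X : Q₁ * s + B * r ≈ X
      Q₁s+Br≈X = trans (+-congʳ (*-inverse-cancelˡ Q₁ Q₁≉0 (X - B * r)))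
                       (solve 2 (λ X u → X :+ :- u :+ u := X) refl X (B * r))
  ... | yes Q₁≈0 = s , 1# , (begin
    s * s * Q₁ + (s * 1# * B + s * 1# * B) + 1# * 1# * Q₂
      ≈⟨ +-congʳ (+-congʳ (*-congˡ Q₁≈0)) ⟩
    s * s * 0# + (s * 1# * B + s * 1# * B) + 1# * 1# * Q₂
      ≈⟨ solve 3 (λ s B Q₂ → s :* s :* :0 :+ (s :* :1 :* B :+ s :* :1 :* B) :+ :1 :* :1 :* Q₂
                             := (:1 :+ :1) :* B :* s :+ Q₂) refl s B Q₂ ⟩
    2B * ((γ - Q₂) * inv 2B 2B≉0) + Q₂  ≈⟨ +-congʳ (*-inverse-cancelˡ 2B 2B≉0 (γ - Q₂)) ⟩
    γ - Q₂ + Q₂                          ≈⟨ solve 2 (λ γ Q₂ → γ :+ :- Q₂ :+ Q₂ := γ) refl γ Q₂ ⟩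
    γ                                    ∎)
    where
    B≉0 : B ≉ 0#
    B≉0 B≈0 = D≉0 (begin
      Q₁ * Q₂ - B * B  ≈⟨ +-cong (*-congʳ Q₁≈0) (-‿cong (*-cong B≈0 B≈0)) ⟩
      0# * Q₂ - 0# * 0# ≈⟨ solve 1 (λ Q₂ → :0 :* Q₂ :+ :- (:0 :* :0) := :0) refl Q₂ ⟩
      0#               ∎)
    2B = (1# + 1#) * B
    2B≉0 = *-≉0 2≉0 B≉0
    s = (γ - Q₂) * inv 2B 2B≉0

  avoid : ∀ {n} → n ℕ.< size → (p : Fin n → Carrier) → ∃ λ x → ∀ j → x ≉ p j
  avoid {n} n<size p with Fin.all? (λ i → Fin.any? (λ j → enum (Fin.inject≤ i n<size) ≟ p j))
  ... | yes hit = ⊥-elim (Fin.<⇒notInjective (ℕ.n<1+n n) injective)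
    where
    injective : ∀ {i j} → proj₁ (hit i) ≡ proj₁ (hit j) → i ≡ j
    injective {i} {j} eq = Fin.inject≤-injective n<size n<size i j (enum-inj _ _
      (trans (proj₂ (hit i)) (trans (reflexive (≡.cong p eq)) (sym (proj₂ (hit j))))))
  ... | no ¬hit with Fin.¬∀⟶∃¬ (suc n) _ (λ i → Fin.any? (λ j → enum (Fin.inject≤ i n<size) ≟ p j)) ¬hit
  ...   | i , missed = enum (Fin.inject≤ i n<size) , λ j eq → missed (j , eq)

  nonzero-coordinate : ∀ {v} → ¬ v ≈ᵥ 0ᵥ → ∃ λ i → v i ≉ 0#
  nonzero-coordinate {v} v≉0 with Fin.any? (λ i → ¬? (v i ≟ 0#))
  ... | yes found = found
  ... | no none   = ⊥-elim (v≉0 λ i → decidable-stable (v i ≟ 0#) (λ vᵢ≉0 → none (i , vᵢ≉0)))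

  dot-witness : ∀ {v} → ¬ v ≈ᵥ 0ᵥ → ∃ λ u → u ∙ v ≉ 0#
  dot-witness {v} v≉0 with nonzero-coordinate v≉0
  ... | i , vᵢ≉0 = unit i , λ eᵢ∙v≈0 → vᵢ≉0 (trans (sym (∙-unitˡ i v)) eᵢ∙v≈0)

  basis-extension : ∀ {v} → ¬ v ≈ᵥ 0ᵥ → ∃₂ λ u w → det₃ v u w ≉ 0#
  basis-extension {v} v≉0 with nonzero-coordinate v≉0
  ... | i , vᵢ≉0 with det₃-units i v
  ...   | u , w , det≈vᵢ = u , w , λ det≈0 → vᵢ≉0 (trans (sym det≈vᵢ) det≈0)

module QuadraticSpace {c ℓ} (F : FiniteField c ℓ) (A : FF.Matrix3 F)
                      (symA : FF.SymmetricM F A) (ndA : FF.NonDegenerate F A) where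

  open FiniteField F
  open FF F
  open FiniteFieldProperties F
  open SymmetricForm commRing (A (# 0) (# 0)) (A (# 0) (# 1)) (A (# 0) (# 2))
                              (A (# 1) (# 1)) (A (# 1) (# 2)) (A (# 2) (# 2))
    public hiding (_≈ᵥ_; 0ᵥ; _+ᵥ_; _-ᵥ_)
  open IntegerCoefficients commRing using (solve; _:=_; _:+_; _:*_; :-_; :0; :1)
  open import Algebra.Properties.Ring ring using (-‿involutive; -0#≈0#)
  open import Relation.Binary.Reasoning.Setoid setoid

  A≈S : ∀ i j → A i j ≈ S i j
  A≈S Fin.zero                     Fin.zero                     = refl
  A≈S Fin.zero                     (Fin.suc Fin.zero)           = refl
  A≈S Fin.zero                     (Fin.suc (Fin.suc Fin.zero)) = refl
  A≈S (Fin.suc Fin.zero)           Fin.zero                     = symA _ _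
  A≈S (Fin.suc Fin.zero)           (Fin.suc Fin.zero)           = refl
  A≈S (Fin.suc Fin.zero)           (Fin.suc (Fin.suc Fin.zero)) = refl
  A≈S (Fin.suc (Fin.suc Fin.zero)) Fin.zero                     = symA _ _
  A≈S (Fin.suc (Fin.suc Fin.zero)) (Fin.suc Fin.zero)           = symA _ _
  A≈S (Fin.suc (Fin.suc Fin.zero)) (Fin.suc (Fin.suc Fin.zero)) = refl

  Q≈q : ∀ x → Q A x ≈ q x
  Q≈q x = quadratic-cong A≈S x

  det≈Δ : det A ≈ Δ
  det≈Δ = determinant-cong A≈S

  B≈β+β : ∀ x y → B A x y ≈ β x y + β x y
  B≈β+β x y = begin
    Q A (x +ᵥ y) - Q A x - Q A y  ≈⟨ +-cong (+-cong (Q≈q (x +ᵥ y)) (-‿cong (Q≈q x))) (-‿cong (Q≈q y)) ⟩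
    q (x +ᵥ y) - q x - q y        ≈⟨ +-congʳ (+-congʳ (q-sum x y)) ⟩
    q x + (β x y + β x y) + q y - q x - q y
      ≈⟨ solve 3 (λ Qx b Qy → Qx :+ (b :+ b) :+ Qy :+ :- Qx :+ :- Qy := b :+ b) refl (q x) (β x y) (q y) ⟩
    β x y + β x y                 ∎

  e₀ : Vec3
  e₀ = unit (# 0)

  e₀≉0 : ¬ e₀ ≈ᵥ 0ᵥ
  e₀≉0 e₀≈0 = 0≉1 (sym (e₀≈0 (# 0)))

  2≉0 : 1# + 1# ≉ 0#
  2≉0 2≈0 = e₀≉0 (ndA e₀ λ y → begin
    B A e₀ y             ≈⟨ B≈β+β e₀ y ⟩
    β e₀ y + β e₀ y      ≈⟨ solve 1 (λ b → b :+ b := (:1 :+ :1) :* b) refl (β e₀ y) ⟩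
    (1# + 1#) * β e₀ y   ≈⟨ *-congʳ 2≈0 ⟩
    0# * β e₀ y          ≈⟨ zeroˡ (β e₀ y) ⟩
    0#                   ∎)

  radical-trivial : ∀ x → (∀ y → β y x ≈ 0#) → x ≈ᵥ 0ᵥ
  radical-trivial x β·x≈0 = ndA x λ y → begin
    B A x y        ≈⟨ B≈β+β x y ⟩
    β x y + β x y  ≈⟨ +-cong (trans (β-sym x y) (β·x≈0 y)) (trans (β-sym x y) (β·x≈0 y)) ⟩
    0# + 0#        ≈⟨ +-identityʳ 0# ⟩
    0#             ∎

  kernel-trivial : ∀ x → (S ⊛ x) ≈ᵥ 0ᵥ → x ≈ᵥ 0ᵥ
  kernel-trivial x Sx≈0 = radical-trivial x λ y →
    trans (∙-cong {y} {y} {S ⊛ x} {0ᵥ} (λ _ → refl) Sx≈0) (∙-zeroʳ y)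

  -- If Δ = 0 then every cross product (S x) ⨯ (S e₀) is in the radical, hence so is
  -- (S e₀) ⨯ u for all u; this contradicts (S e₀) ≠ 0 extending to a basis.
  Δ≉0 : Δ ≉ 0#
  Δ≉0 Δ≈0 = no-basis (basis-extension {w} (e₀≉0 ∘ kernel-trivial e₀))
    where
    w = S ⊛ e₀

    image-cross : ∀ x → ((S ⊛ x) ⨯ w) ≈ᵥ 0ᵥ
    image-cross x = radical-trivial ((S ⊛ x) ⨯ w) λ z → begin
      β z ((S ⊛ x) ⨯ w)       ≈⟨ β-transpose z ((S ⊛ x) ⨯ w) ⟩
      det₃ (S ⊛ z) (S ⊛ x) w  ≈⟨ det₃-image z x e₀ ⟩
      Δ * det₃ z x e₀         ≈⟨ *-congʳ Δ≈0 ⟩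
      0# * det₃ z x e₀        ≈⟨ zeroˡ (det₃ z x e₀) ⟩
      0#                      ∎

    no-basis : (∃₂ λ u₁ u₂ → det₃ w u₁ u₂ ≉ 0#) → ⊥
    no-basis (u₁ , u₂ , det≉0) = det≉0 (begin
      det₃ w u₁ u₂     ≈⟨ det₃-rotate w u₁ u₂ ⟩
      u₂ ∙ (w ⨯ u₁)    ≈⟨ ∙-cong {u₂} {u₂} {w ⨯ u₁} {0ᵥ} (λ _ → refl) w⨯u₁≈0 ⟩
      u₂ ∙ 0ᵥ          ≈⟨ ∙-zeroʳ u₂ ⟩
      0#               ∎)
      where
      w⨯u₁≈0 : (w ⨯ u₁) ≈ᵥ 0ᵥ
      w⨯u₁≈0 = radical-trivial (w ⨯ u₁) λ x → begin
        β x (w ⨯ u₁)            ≈⟨ β-transpose x (w ⨯ u₁) ⟩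
        det₃ (S ⊛ x) w u₁       ≈⟨ det₃-rotate (S ⊛ x) w u₁ ⟩
        u₁ ∙ ((S ⊛ x) ⨯ w)      ≈⟨ ∙-cong {u₁} {u₁} {(S ⊛ x) ⨯ w} {0ᵥ} (λ _ → refl) (image-cross x) ⟩
        u₁ ∙ 0ᵥ                 ≈⟨ ∙-zeroʳ u₁ ⟩
        0#                      ∎

  β-witness : ∀ {v} → ¬ v ≈ᵥ 0ᵥ → ∃ λ u → β v u ≉ 0#
  β-witness {v} v≉0 = let (u , u∙Sv≉0) = dot-witness {S ⊛ v} (v≉0 ∘ kernel-trivial v)
                      in u , λ βvu≈0 → u∙Sv≉0 (trans (β-sym u v) βvu≈0)

  anisotropic⇒nonzero : ∀ {v} → q v ≉ 0# → ¬ v ≈ᵥ 0ᵥ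
  anisotropic⇒nonzero {v} qv≉0 v≈0 = qv≉0 (trans (q-cong {v} {0ᵥ} v≈0) q-zero)

  orthogonal-plane : ∀ {v} → q v ≉ 0# →
    ∃₂ λ w₁ w₂ → β v w₁ ≈ 0# × β v w₂ ≈ 0# × q w₁ * q w₂ - β w₁ w₂ * β w₁ w₂ ≉ 0#
  orthogonal-plane {v} qv≉0 = plane (basis-extension {S ⊛ v} (anisotropic⇒nonzero qv≉0 ∘ kernel-trivial v))
    where
    -- q v · Gram(w₁, w₂) = Gram(v, w₁, w₂) = det₃(v, w₁, w₂)² Δ and det₃(v, w₁, w₂) = q v · d
    plane : (∃₂ λ u₁ u₂ → det₃ (S ⊛ v) u₁ u₂ ≉ 0#) →
            ∃₂ λ w₁ w₂ → β v w₁ ≈ 0# × β v w₂ ≈ 0# × q w₁ * q w₂ - β w₁ w₂ * β w₁ w₂ ≉ 0#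
    plane (u₁ , u₂ , d≉0) = w₁ , w₂ , cross-orthogonal v u₁ , cross-orthogonal v u₂ , D≉0
      where
      w₁ = (S ⊛ v) ⨯ u₁
      w₂ = (S ⊛ v) ⨯ u₂
      δ = det₃ v w₁ w₂
      δ≉0 : δ ≉ 0#
      δ≉0 δ≈0 = *-≉0 qv≉0 d≉0 (begin
        q v * det₃ (S ⊛ v) u₁ u₂  ≈⟨ *-congʳ (β-self v) ⟨
        β v v * det₃ (S ⊛ v) u₁ u₂ ≈⟨ det₃-cross (S ⊛ v) u₁ u₂ v ⟨
        δ                          ≈⟨ δ≈0 ⟩
        0#                         ∎)
      D≉0 : q w₁ * q w₂ - β w₁ w₂ * β w₁ w₂ ≉ 0#
      D≉0 D≈0 = *-≉0 (*-≉0 δ≉0 δ≉0) Δ≉0 (begin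
        δ * δ * Δ                                   ≈⟨ gram-det₃ v w₁ w₂ ⟨
        gram S v w₁ w₂
          ≈⟨ gram-orthogonal v w₁ w₂ (cross-orthogonal v u₁) (cross-orthogonal v u₂) ⟩
        q v * (q w₁ * q w₂ - β w₁ w₂ * β w₁ w₂)     ≈⟨ *-congˡ D≈0 ⟩
        q v * 0#                                    ≈⟨ zeroʳ (q v) ⟩
        0#                                          ∎)

  orthogonal-complement-universal : ∀ {v} → q v ≉ 0# → ∀ γ → ∃ λ y → β v y ≈ 0# × q y ≈ γ
  orthogonal-complement-universal {v} qv≉0 γ =
    let (w₁ , w₂ , vw₁≈0 , vw₂≈0 , D≉0) = orthogonal-plane {v} qv≉0
        (s , r , g≈γ) = binary-form-universal {q w₁} {q w₂} {β w₁ w₂} 2≉0 D≉0 γ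
    in (s ·ᵥ w₁) +ᵥ (r ·ᵥ w₂)
     , trans (β-combination s r v w₁ w₂)
             (trans (+-cong (*-congˡ vw₁≈0) (*-congˡ vw₂≈0))
                    (solve 2 (λ s r → s :* :0 :+ r :* :0 := :0) refl s r))
     , trans (q-combination s r w₁ w₂) g≈γ

  isotropic-vector : ∃ λ v → ¬ v ≈ᵥ 0ᵥ × q v ≈ 0#
  isotropic-vector with q e₀ ≟ 0#
  ... | yes qe₀≈0 = e₀ , e₀≉0 , qe₀≈0
  ... | no  qe₀≉0 = hyperbolic (orthogonal-complement-universal {e₀} qe₀≉0 (- q e₀))
    where
    hyperbolic : (∃ λ y → β e₀ y ≈ 0# × q y ≈ - q e₀) → ∃ λ v → ¬ v ≈ᵥ 0ᵥ × q v ≈ 0#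
    hyperbolic (y , e₀y≈0 , qy≈-qe₀) = u , u≉0 , qu≈0
      where
      u = (1# ·ᵥ e₀) +ᵥ (1# ·ᵥ y)
      qu≈0 : q u ≈ 0#
      qu≈0 = begin
        q u  ≈⟨ q-combination 1# 1# e₀ y ⟩
        1# * 1# * q e₀ + (1# * 1# * β e₀ y + 1# * 1# * β e₀ y) + 1# * 1# * q y
             ≈⟨ +-cong (+-congˡ (+-cong (*-congˡ e₀y≈0) (*-congˡ e₀y≈0))) (*-congˡ qy≈-qe₀) ⟩
        1# * 1# * q e₀ + (1# * 1# * 0# + 1# * 1# * 0#) + 1# * 1# * - q e₀
             ≈⟨ solve 1 (λ Q → :1 :* :1 :* Q :+ (:1 :* :1 :* :0 :+ :1 :* :1 :* :0) :+ :1 :* :1 :* :- Q := :0)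
                        refl (q e₀) ⟩
        0#   ∎
      u≉0 : ¬ u ≈ᵥ 0ᵥ
      u≉0 u≈0 = qe₀≉0 (begin
        q e₀                     ≈⟨ solve 1 (λ Q → :1 :* Q :+ :1 :* :0 := Q) refl (q e₀) ⟨
        1# * q e₀ + 1# * 0#      ≈⟨ +-cong (*-congˡ (β-self e₀)) (*-congˡ e₀y≈0) ⟨
        1# * β e₀ e₀ + 1# * β e₀ y ≈⟨ β-combination 1# 1# e₀ e₀ y ⟨
        β e₀ u                   ≈⟨ β-cong {e₀} {e₀} {u} {0ᵥ} (λ _ → refl) u≈0 ⟩
        β e₀ 0ᵥ                  ≈⟨ β-zeroʳ e₀ ⟩
        0#                       ∎)

  isotropic-orthogonal-values : ∀ {v γ} → q v ≈ 0# → ¬ v ≈ᵥ 0ᵥ → SqClassEq (det A) (- γ) →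
                                ∃ λ x → β v x ≈ 0# × q x ≈ γ
  isotropic-orthogonal-values {v} {γ} qv≈0 v≉0 (t , t≉0 , det≈-γt²) = scaled-cross (dot-witness {v} v≉0)
    where
    Δ≈-γt² = trans (sym det≈Δ) det≈-γt²
    scaled-cross : (∃ λ u → u ∙ v ≉ 0#) → ∃ λ x → β v x ≈ 0# × q x ≈ γ
    scaled-cross (u , u∙v≉0) = σ ·ᵥ w , v⊥x , qx≈γ
      where
      w = (S ⊛ v) ⨯ u
      τ = t * (u ∙ v)
      τ≉0 = *-≉0 t≉0 u∙v≉0
      σ = inv τ τ≉0
      qw≈γτ² : q w ≈ γ * (τ * τ)
      qw≈γτ² = begin
        q w  ≈⟨ cross-quadratic v u ⟩
        quadratic (adjugate S) u * q v - Δ * ((u ∙ v) * (u ∙ v))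
             ≈⟨ +-cong (*-congˡ qv≈0) (-‿cong (*-congʳ Δ≈-γt²)) ⟩
        quadratic (adjugate S) u * 0# - (- γ * (t * t)) * ((u ∙ v) * (u ∙ v))
             ≈⟨ solve 4 (λ C γ t p → C :* :0 :+ :- ((:- γ :* (t :* t)) :* (p :* p))
                                     := γ :* ((t :* p) :* (t :* p)))
                        refl (quadratic (adjugate S) u) γ t (u ∙ v) ⟩
        γ * (τ * τ) ∎
      qx≈γ : q (σ ·ᵥ w) ≈ γ
      qx≈γ = begin
        q (σ ·ᵥ w)               ≈⟨ q-scale σ w ⟩
        σ * σ * q w              ≈⟨ *-congˡ qw≈γτ² ⟩
        σ * σ * (γ * (τ * τ))
          ≈⟨ solve 3 (λ σ γ τ → σ :* σ :* (γ :* (τ :* τ)) := γ :* ((τ :* σ) :* (τ :* σ))) refl σ γ τ ⟩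
        γ * ((τ * σ) * (τ * σ))  ≈⟨ *-congˡ (*-cong (*-inverseʳ τ τ≉0) (*-inverseʳ τ τ≉0)) ⟩
        γ * (1# * 1#)            ≈⟨ trans (*-congˡ (*-identityˡ 1#)) (*-identityʳ γ) ⟩
        γ                        ∎
      v⊥x : β v (σ ·ᵥ w) ≈ 0#
      v⊥x = trans (β-scale σ v w) (trans (*-congˡ (cross-orthogonal v u)) (zeroʳ σ))

  isotropic-orthogonal-square-class : ∀ {v x} → q v ≈ 0# → ¬ v ≈ᵥ 0ᵥ → β v x ≈ 0# → q x ≉ 0# →
                                      SqClassEq (det A) (- q x)
  isotropic-orthogonal-square-class {v} {x} qv≈0 v≉0 vx≈0 qx≉0 = from-gram (β-witness {v} v≉0)
    where
    from-gram : (∃ λ u → β v u ≉ 0#) → SqClassEq (det A) (- q x)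
    from-gram (u , p≉0) = p * δ⁻¹ , *-≉0 p≉0 (inv-≉0 δ δ≉0) , trans det≈Δ Δ≈-qx[p/δ]²
      where
      p = β v u
      δ = det₃ v x u
      gram-identity : δ * δ * Δ ≈ - (q x * (p * p))
      gram-identity = trans (sym (gram-det₃ v x u)) (gram-isotropic v x u qv≈0 vx≈0)
      δ≉0 : δ ≉ 0#
      δ≉0 δ≈0 = *-≉0 qx≉0 (*-≉0 p≉0 p≉0) (begin
        q x * (p * p)        ≈⟨ -‿involutive _ ⟨
        - - (q x * (p * p))  ≈⟨ -‿cong gram-identity ⟨
        - (δ * δ * Δ)        ≈⟨ -‿cong (trans (*-congʳ (*-congʳ δ≈0)) (trans (*-congʳ (zeroˡ δ)) (zeroˡ Δ))) ⟩
        - 0#                 ≈⟨ -0#≈0# ⟩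
        0#                   ∎)
      δ⁻¹ = inv δ δ≉0
      Δ≈-qx[p/δ]² : Δ ≈ - q x * ((p * δ⁻¹) * (p * δ⁻¹))
      Δ≈-qx[p/δ]² = begin
        Δ                                 ≈⟨ *-identityˡ Δ ⟨
        1# * Δ
          ≈⟨ *-congʳ (trans (*-cong (*-inverseʳ δ δ≉0) (*-inverseʳ δ δ≉0)) (*-identityˡ 1#)) ⟨
        (δ * δ⁻¹) * (δ * δ⁻¹) * Δ
          ≈⟨ solve 3 (λ δ δ⁻¹ Δ → (δ :* δ⁻¹) :* (δ :* δ⁻¹) :* Δ := (δ⁻¹ :* δ⁻¹) :* (δ :* δ :* Δ)) refl δ δ⁻¹ Δ ⟩
        (δ⁻¹ * δ⁻¹) * (δ * δ * Δ)
          ≈⟨ *-congˡ gram-identity ⟩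
        (δ⁻¹ * δ⁻¹) * - (q x * (p * p))
          ≈⟨ solve 3 (λ δ⁻¹ Q p → (δ⁻¹ :* δ⁻¹) :* :- (Q :* (p :* p)) := :- Q :* ((p :* δ⁻¹) :* (p :* δ⁻¹)))
                     refl δ⁻¹ (q x) p ⟩
        - q x * ((p * δ⁻¹) * (p * δ⁻¹))   ∎

module RepresentationGraph {c ℓ} (F : FiniteField c ℓ) (A : FF.Matrix3 F)
  (symA : FF.SymmetricM F A) (ndA : FF.NonDegenerate F A)
  (a : FiniteField.Carrier F) (a≉0 : ¬ FiniteField._≈_ F a (FiniteField.0# F)) where

  open FiniteField F
  open FF F
  open FiniteFieldProperties F
  open QuadraticSpace F A symA ndA
  open IntegerCoefficients commRing using (solve; _:=_; _:+_; _:*_; :-_; :0; :1)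
  open import Relation.Binary.Reasoning.Setoid setoid
  open import Algebra.Properties.Ring ring using (-0#≈0#)

  adjacent : ∀ {x y} → q (x -ᵥ y) ≈ a → Adj A a x y
  adjacent {x} {y} qx-y≈a = x≉y , trans (Q≈q (x -ᵥ y)) qx-y≈a
    where
    x≉y : ¬ x ≈ᵥ y
    x≉y x≈y = a≉0 (begin
      a           ≈⟨ qx-y≈a ⟨
      q (x -ᵥ y)  ≈⟨ q-cong {x -ᵥ y} {0ᵥ} (λ i → trans (+-congʳ (x≈y i)) (-‿inverseʳ (y i))) ⟩
      q 0ᵥ        ≈⟨ q-zero ⟩
      0#          ∎)

  adjacent⁻¹ : ∀ {x y} → Adj A a x y → q (x -ᵥ y) ≈ a
  adjacent⁻¹ {x} {y} (_ , Qx-y≈a) = trans (sym (Q≈q (x -ᵥ y))) Qx-y≈a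

  Within-refl : ∀ k {x y} → x ≈ᵥ y → Within A a k x y
  Within-refl zero    x≈y = lift x≈y
  Within-refl (suc k) x≈y = inj₁ (lift x≈y)

  Within-suc : ∀ k {x y} → Within A a k x y → Within A a (suc k) x y
  Within-suc zero    x≈y                  = inj₁ x≈y
  Within-suc (suc k) (inj₁ x≈y)           = inj₁ x≈y
  Within-suc (suc k) (inj₂ (z , xz , zy)) = inj₂ (z , xz , Within-suc k zy)

  Within-≤′ : ∀ {m n x y} → m ℕ.≤′ n → Within A a m x y → Within A a n x y
  Within-≤′ ℕ.≤′-refl        w = w
  Within-≤′ (ℕ.≤′-step m≤′n) w = Within-suc _ (Within-≤′ m≤′n w)

  Within-translate : ∀ k t {x y x′ y′} → x′ ≈ᵥ (x +ᵥ t) → y′ ≈ᵥ (y +ᵥ t) →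
                     Within A a k x y → Within A a k x′ y′
  Within-translate k t {x} {y} {x′} {y′} x′≈x+t y′≈y+t w = go k w
    where
    shift : x ≈ᵥ y → x′ ≈ᵥ y′
    shift x≈y i = trans (x′≈x+t i) (trans (+-congʳ (x≈y i)) (sym (y′≈y+t i)))
    go : ∀ k → Within A a k x y → Within A a k x′ y′
    go zero    (lift x≈y)           = lift (shift x≈y)
    go (suc k) (inj₁ (lift x≈y))    = inj₁ (lift (shift x≈y))
    go (suc k) (inj₂ (z , xz , zy)) =
      inj₂ (z +ᵥ t , adjacent qx′-z′≈a , Within-translate k t (λ _ → refl) y′≈y+t zy)
      where
      qx′-z′≈a : q (x′ -ᵥ (z +ᵥ t)) ≈ a
      qx′-z′≈a = trans (q-cong {x′ -ᵥ (z +ᵥ t)} {x -ᵥ z} λ i →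
                         trans (+-congʳ (x′≈x+t i))
                               (solve 3 (λ x z t → x :+ t :+ :- (z :+ t) := x :+ :- z) refl (x i) (z i) (t i)))
                       (adjacent⁻¹ xz)

  within-from-origin : ∀ k {x y} → Within A a k 0ᵥ (y -ᵥ x) → Within A a k x y
  within-from-origin k {x} {y} = Within-translate k x (λ i → sym (+-identityˡ (x i)))
    (λ i → solve 2 (λ x y → y := y :+ :- x :+ x) refl (x i) (y i))

  everywhere : ∀ k → (∀ {v} → ¬ v ≈ᵥ 0ᵥ → Within A a k 0ᵥ v) → ∀ x y → Within A a k x y
  everywhere k nonzero x y with Fin.all? (λ i → (y -ᵥ x) i ≟ 0#)
  ... | yes y-x≈0 = within-from-origin k (Within-refl k λ i → sym (y-x≈0 i))
  ... | no  y-x≉0 = within-from-origin k (nonzero y-x≉0)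

  two-steps : ∀ x {v} → q x ≈ a → q (x -ᵥ v) ≈ a → Within A a 2 0ᵥ v
  two-steps x {v} qx≈a qx-v≈a =
    inj₂ (x , adjacent (trans (q-neg x) qx≈a) , inj₂ (v , adjacent qx-v≈a , lift λ _ → refl))

  two-steps⁻¹ : ∀ {v} → ¬ v ≈ᵥ 0ᵥ → q v ≉ a → Within A a 2 0ᵥ v → ∃ λ x → q x ≈ a × q (x -ᵥ v) ≈ a
  two-steps⁻¹ v≉0 qv≉a (inj₁ (lift 0≈v)) = ⊥-elim (v≉0 λ i → sym (0≈v i))
  two-steps⁻¹ {v} v≉0 qv≉a (inj₂ (x , 0x , inj₁ (lift x≈v))) =
    ⊥-elim (qv≉a (trans (q-cong {v} {x} λ i → sym (x≈v i)) (trans (sym (q-neg x)) (adjacent⁻¹ 0x))))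
  two-steps⁻¹ {v} v≉0 qv≉a (inj₂ (x , 0x , inj₂ (z , xz , lift z≈v))) =
    x , trans (sym (q-neg x)) (adjacent⁻¹ 0x)
      , trans (q-cong {x -ᵥ v} {x -ᵥ z} λ i → +-congˡ (-‿cong (sym (z≈v i)))) (adjacent⁻¹ xz)

  not-within-1 : ∀ {v} → ¬ v ≈ᵥ 0ᵥ → q v ≉ a → ¬ Within A a 1 0ᵥ v
  not-within-1 v≉0 qv≉a (inj₁ (lift 0≈v)) = v≉0 λ i → sym (0≈v i)
  not-within-1 {v} v≉0 qv≉a (inj₂ (x , 0x , lift x≈v)) =
    qv≉a (trans (q-cong {v} {x} λ i → sym (x≈v i)) (trans (sym (q-neg x)) (adjacent⁻¹ 0x)))

  anisotropic-within-2 : ∀ {v} → q v ≉ 0# → Within A a 2 0ᵥ v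
  anisotropic-within-2 {v} qv≉0 = via-midpoint (orthogonal-complement-universal {v} qv≉0 (a - h * h * q v))
    where
    h = inv (1# + 1#) 2≉0
    via-midpoint : (∃ λ y → β v y ≈ 0# × q y ≈ a - h * h * q v) → Within A a 2 0ᵥ v
    via-midpoint (y , vy≈0 , qy≈a-h²qv) = two-steps x qx≈a qx-v≈a
      where
      x = (h ·ᵥ v) +ᵥ (1# ·ᵥ y)
      qx≈a : q x ≈ a
      qx≈a = begin
        q x  ≈⟨ q-combination h 1# v y ⟩
        h * h * q v + (h * 1# * β v y + h * 1# * β v y) + 1# * 1# * q y
             ≈⟨ +-cong (+-congˡ (+-cong (*-congˡ vy≈0) (*-congˡ vy≈0))) (*-congˡ qy≈a-h²qv) ⟩
        h * h * q v + (h * 1# * 0# + h * 1# * 0#) + 1# * 1# * (a - h * h * q v)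
             ≈⟨ solve 3 (λ h Q a → h :* h :* Q :+ (h :* :1 :* :0 :+ h :* :1 :* :0)
                                   :+ :1 :* :1 :* (a :+ :- (h :* h :* Q)) := a)
                        refl h (q v) a ⟩
        a    ∎
      βxv≈hqv : β x v ≈ h * q v
      βxv≈hqv = begin
        β x v                   ≈⟨ β-sym x v ⟩
        β v x                   ≈⟨ β-combination h 1# v v y ⟩
        h * β v v + 1# * β v y  ≈⟨ +-cong (*-congˡ (β-self v)) (*-congˡ vy≈0) ⟩
        h * q v + 1# * 0#       ≈⟨ solve 2 (λ h Q → h :* Q :+ :1 :* :0 := h :* Q) refl h (q v) ⟩
        h * q v                 ∎
      qx-v≈a : q (x -ᵥ v) ≈ a
      qx-v≈a = begin
        q (x -ᵥ v)                          ≈⟨ q-diff x v ⟩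
        q x - (β x v + β x v) + q v         ≈⟨ +-congʳ (+-cong qx≈a (-‿cong (+-cong βxv≈hqv βxv≈hqv))) ⟩
        a - (h * q v + h * q v) + q v
          ≈⟨ solve 3 (λ a h Q → a :+ :- (h :* Q :+ h :* Q) :+ Q := a :+ :- ((:1 :+ :1) :* h :* Q) :+ Q)
                     refl a h (q v) ⟩
        a - (1# + 1#) * h * q v + q v
          ≈⟨ +-congʳ (+-congˡ (-‿cong (*-congʳ (*-inverseʳ (1# + 1#) 2≉0)))) ⟩
        a - 1# * q v + q v                  ≈⟨ solve 2 (λ a Q → a :+ :- (:1 :* Q) :+ Q := a) refl a (q v) ⟩
        a                                   ∎

  q-diff-isotropic : ∀ v x → q v ≈ 0# → q (x -ᵥ v) ≈ q x - (β v x + β v x)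
  q-diff-isotropic v x qv≈0 = begin
    q (x -ᵥ v)                    ≈⟨ q-diff x v ⟩
    q x - (β x v + β x v) + q v   ≈⟨ +-cong (+-congˡ (-‿cong (+-cong (β-sym x v) (β-sym x v)))) qv≈0 ⟩
    q x - (β v x + β v x) + 0#    ≈⟨ +-identityʳ _ ⟩
    q x - (β v x + β v x)         ∎

  isotropic-within-2 : ∀ {v} → q v ≈ 0# → ¬ v ≈ᵥ 0ᵥ → SqClassEq (det A) (- a) → Within A a 2 0ᵥ v
  isotropic-within-2 {v} qv≈0 v≉0 sq = common-neighbour (isotropic-orthogonal-values {v} {a} qv≈0 v≉0 sq)
    where
    common-neighbour : (∃ λ x → β v x ≈ 0# × q x ≈ a) → Within A a 2 0ᵥ v
    common-neighbour (x , vx≈0 , qx≈a) = two-steps x qx≈a (begin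
      q (x -ᵥ v)              ≈⟨ q-diff-isotropic v x qv≈0 ⟩
      q x - (β v x + β v x)   ≈⟨ +-cong qx≈a (-‿cong (+-cong vx≈0 vx≈0)) ⟩
      a - (0# + 0#)           ≈⟨ solve 1 (λ a → a :+ :- (:0 :+ :0) := a) refl a ⟩
      a                       ∎)

  isotropic-within-2⁻¹ : ∀ {v} → q v ≈ 0# → ¬ v ≈ᵥ 0ᵥ → Within A a 2 0ᵥ v → SqClassEq (det A) (- a)
  isotropic-within-2⁻¹ {v} qv≈0 v≉0 near =
    square-class (two-steps⁻¹ {v} v≉0 (λ qv≈a → a≉0 (trans (sym qv≈a) qv≈0)) near)
    where
    square-class : (∃ λ x → q x ≈ a × q (x -ᵥ v) ≈ a) → SqClassEq (det A) (- a)
    square-class (x , qx≈a , qx-v≈a) =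
      let (t , t≉0 , det≈-qxt²) = isotropic-orthogonal-square-class {v} {x} qv≈0 v≉0 vx≈0
                                     (λ qx≈0 → a≉0 (trans (sym qx≈a) qx≈0))
      in t , t≉0 , trans det≈-qxt² (*-congʳ (-‿cong qx≈a))
      where
      -- q (x - v) = q x forces 2 β v x = 0
      vx≈0 : β v x ≈ 0#
      vx≈0 = *-cancelˡ (1# + 1#) 2≉0 (begin
        (1# + 1#) * β v x
          ≈⟨ solve 2 (λ b a → (:1 :+ :1) :* b := a :+ :- (a :+ :- (b :+ b))) refl (β v x) a ⟩
        a - (a - (β v x + β v x))    ≈⟨ +-congˡ (-‿cong (+-congʳ qx≈a)) ⟨
        a - (q x - (β v x + β v x))  ≈⟨ +-congˡ (-‿cong (q-diff-isotropic v x qv≈0)) ⟨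
        a - q (x -ᵥ v)               ≈⟨ +-congˡ (-‿cong qx-v≈a) ⟩
        a - a                        ≈⟨ -‿inverseʳ a ⟩
        0#                           ≈⟨ zeroʳ (1# + 1#) ⟨
        (1# + 1#) * 0#               ∎)

  isotropic-within-3 : ∀ {v} → q v ≈ 0# → ¬ v ≈ᵥ 0ᵥ → Within A a 3 0ᵥ v
  isotropic-within-3 {v} qv≈0 v≉0 = via-neighbour (β-witness {v} v≉0)
    where
    -- a neighbour x of 0 with β v x = a, so that q (v - x) = -a ≠ 0
    via-neighbour : (∃ λ u → β v u ≉ 0#) → Within A a 3 0ᵥ v
    via-neighbour (u , p≉0) =
      inj₂ (x , adjacent (trans (q-neg x) qx≈a) , within-from-origin 2 (anisotropic-within-2 {v -ᵥ x} qv-x≉0))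
      where
      u₁ = inv (β v u) p≉0 ·ᵥ u
      h  = inv (1# + 1#) 2≉0
      l  = h * (1# - a * q u₁)
      x  = (l ·ᵥ v) +ᵥ (a ·ᵥ u₁)
      vu₁≈1 : β v u₁ ≈ 1#
      vu₁≈1 = trans (β-scale (inv (β v u) p≉0) v u) (trans (*-comm _ _) (*-inverseʳ (β v u) p≉0))
      qx≈a : q x ≈ a
      qx≈a = begin
        q x  ≈⟨ q-combination l a v u₁ ⟩
        l * l * q v + (l * a * β v u₁ + l * a * β v u₁) + a * a * q u₁
             ≈⟨ +-congʳ (+-cong (*-congˡ qv≈0) (+-cong (*-congˡ vu₁≈1) (*-congˡ vu₁≈1))) ⟩
        l * l * 0# + (l * a * 1# + l * a * 1#) + a * a * q u₁
             ≈⟨ solve 3 (λ h a Q → let l = h :* (:1 :+ :- (a :* Q)) in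
                          l :* l :* :0 :+ (l :* a :* :1 :+ l :* a :* :1) :+ a :* a :* Q
                          := (:1 :+ :1) :* h :* ((:1 :+ :- (a :* Q)) :* a) :+ a :* a :* Q)
                        refl h a (q u₁) ⟩
        (1# + 1#) * h * ((1# - a * q u₁) * a) + a * a * q u₁
             ≈⟨ +-congʳ (*-congʳ (*-inverseʳ (1# + 1#) 2≉0)) ⟩
        1# * ((1# - a * q u₁) * a) + a * a * q u₁
             ≈⟨ solve 2 (λ a Q → :1 :* ((:1 :+ :- (a :* Q)) :* a) :+ a :* a :* Q := a) refl a (q u₁) ⟩
        a    ∎
      vx≈a : β v x ≈ a
      vx≈a = begin
        β v x                     ≈⟨ β-combination l a v v u₁ ⟩
        l * β v v + a * β v u₁    ≈⟨ +-cong (*-congˡ (trans (β-self v) qv≈0)) (*-congˡ vu₁≈1) ⟩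
        l * 0# + a * 1#           ≈⟨ solve 2 (λ l a → l :* :0 :+ a :* :1 := a) refl l a ⟩
        a                         ∎
      qv-x≉0 : q (v -ᵥ x) ≉ 0#
      qv-x≉0 qv-x≈0 = a≉0 (begin
        a                              ≈⟨ solve 1 (λ a → a := :- (:0 :+ :- (a :+ a) :+ a)) refl a ⟩
        - (0# - (a + a) + a)           ≈⟨ -‿cong (+-cong (+-cong qv≈0 (-‿cong (+-cong vx≈a vx≈a))) qx≈a) ⟨
        - (q v - (β v x + β v x) + q x) ≈⟨ -‿cong (q-diff v x) ⟨
        - q (v -ᵥ x)                   ≈⟨ -‿cong qv-x≈0 ⟩
        - 0#                           ≈⟨ -0#≈0# ⟩
        0#                             ∎)

  nonzero-within-2 : SqClassEq (det A) (- a) → ∀ {v} → ¬ v ≈ᵥ 0ᵥ → Within A a 2 0ᵥ v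
  nonzero-within-2 sq {v} v≉0 with q v ≟ 0#
  ... | no  qv≉0 = anisotropic-within-2 qv≉0
  ... | yes qv≈0 = isotropic-within-2 qv≈0 v≉0 sq

  nonzero-within-3 : ∀ {v} → ¬ v ≈ᵥ 0ᵥ → Within A a 3 0ᵥ v
  nonzero-within-3 {v} v≉0 with q v ≟ 0#
  ... | no  qv≉0 = Within-suc 2 (anisotropic-within-2 qv≉0)
  ... | yes qv≈0 = isotropic-within-3 qv≈0 v≉0

  non-neighbour : 3 ℕ.< size → ∃ λ v → ¬ v ≈ᵥ 0ᵥ × q v ≉ a
  non-neighbour 3<size with q e₀ ≟ a
  ... | no  qe₀≉a = e₀ , e₀≉0 , qe₀≉a
  ... | yes qe₀≈a = rescaled (avoid 3<size (0# ∷ 1# ∷ - 1# ∷ []))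
    where
    rescaled : (∃ λ s → ∀ j → s ≉ (0# ∷ 1# ∷ - 1# ∷ []) j) → ∃ λ v → ¬ v ≈ᵥ 0ᵥ × q v ≉ a
    rescaled (s , fresh) = s ·ᵥ e₀ , se₀≉0 , qse₀≉a
      where
      se₀≉0 : ¬ (s ·ᵥ e₀) ≈ᵥ 0ᵥ
      se₀≉0 se₀≈0 = fresh (# 0) (trans (sym (*-identityʳ s)) (se₀≈0 (# 0)))
      qse₀≉a : q (s ·ᵥ e₀) ≉ a
      qse₀≉a qse₀≈a = [ fresh (# 1) , fresh (# 2) ]′ (square-root (*-cancelˡ a a≉0 (begin
        a * (s * s)        ≈⟨ *-comm a (s * s) ⟩
        s * s * a          ≈⟨ *-congˡ qe₀≈a ⟨
        s * s * q e₀       ≈⟨ q-scale s e₀ ⟨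
        q (s ·ᵥ e₀)        ≈⟨ qse₀≈a ⟩
        a                  ≈⟨ trans (*-congˡ (*-identityˡ 1#)) (*-identityʳ a) ⟨
        a * (1# * 1#)      ∎)))

  has-diameter : ∀ n → (∀ x y → Within A a (suc n) x y) → (∃₂ λ x y → ¬ Within A a n x y) →
                 HasDiameter A a (suc n)
  has-diameter n near (x , y , far) = near , λ m within-m →
    ℕ.≮⇒≥ λ m<1+n → far (Within-≤′ (ℕ.≤⇒≤′ (ℕ.s≤s⁻¹ m<1+n)) (within-m x y))

  far-from-origin : ∀ v → ¬ v ≈ᵥ 0ᵥ → (¬ Within A a 2 0ᵥ v) ⇔ (Q A v ≈ 0# × ¬ SqClassEq (det A) (- a))
  far-from-origin v v≉0 = mk⇔ to from
    where
    to : ¬ Within A a 2 0ᵥ v → Q A v ≈ 0# × ¬ SqClassEq (det A) (- a)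
    to far with q v ≟ 0#
    ... | no  qv≉0 = ⊥-elim (far (anisotropic-within-2 qv≉0))
    ... | yes qv≈0 = trans (Q≈q v) qv≈0 , λ sq → far (isotropic-within-2 qv≈0 v≉0 sq)
    from : Q A v ≈ 0# × ¬ SqClassEq (det A) (- a) → ¬ Within A a 2 0ᵥ v
    from (Qv≈0 , ¬sq) near = ¬sq (isotropic-within-2⁻¹ (trans (sym (Q≈q v)) Qv≈0) v≉0 near)

  diameter-2 : 3 ℕ.< size → SqClassEq (det A) (- a) → HasDiameter A a 2
  diameter-2 3<size sq =
    let (v , v≉0 , qv≉a) = non-neighbour 3<size
    in has-diameter 1 (everywhere 2 (nonzero-within-2 sq)) (0ᵥ , v , not-within-1 v≉0 qv≉a)

  diameter-3 : ¬ SqClassEq (det A) (- a) → HasDiameter A a 3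
  diameter-3 ¬sq =
    let (v , v≉0 , qv≈0) = isotropic-vector
    in has-diameter 2 (everywhere 3 nonzero-within-3) (0ᵥ , v , ¬sq ∘ isotropic-within-2⁻¹ qv≈0 v≉0)

lemma3p16 : ∀ {c ℓ} (F : FiniteField c ℓ) →
    let open FiniteField F
        open FF F
    in (A : Matrix3) → SymmetricM A → NonDegenerate A →
       (a : Carrier) → ¬ (a ≈ 0#) →
       ((v : Vec3) → ¬ (v ≈ᵥ 0ᵥ) →
          ((¬ Within A a 2 0ᵥ v) ⇔ (Q A v ≈ 0# × ¬ SqClassEq (det A) (- a))))
       × (5 ≤ size →
            (SqClassEq (det A) (- a) → HasDiameter A a 2)
            × (¬ SqClassEq (det A) (- a) → HasDiameter A a 3))
lemma3p16 F A symA ndA a a≉0 =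
  far-from-origin , λ 5≤size → diameter-2 (ℕ.<⇒≤ 5≤size) , diameter-3
  where open RepresentationGraph F A symA ndA a a≉0
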